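{- Let $H$ and $K$ be connected graphs with weight functions $\alpha:V_H\to[0,\infty)$ and $\beta:V_K\to[0,\infty)$, and let $B=\sum_{v\in V_K}\beta(v)$. Let $x_1,\ldots,x_r,x\in V_H$ and $y\in V_K$. Let $G_1$ be the graph obtained from the disjoint union of $H$ and $r$ copies $K^{(1)},\ldots,K^{(r)}$ of $K$ by identifying, for each $i$, the vertex $x_i$ with the copy of $y$ in $K^{(i)}$, and let $G_2$ be obtained in the same way but identifying the copy of $y$ in every $K^{(i)}$ with the single vertex $x$. Give both graphs the weight function $\gamma=\alpha+\beta+\cdots+\beta$ ($r$ copies of $\beta$). Then $$ M_{G_2}^{\gamma}-M_{G_1}^{\gamma}=\sum_{i=1}^r\left[M_H^{\xi}(x)-M_H^{\xi}(x_i)\right]-B(|V_K|-1)\sum_{i,j=1}^r \operatorname{dist}_H(x_i,x_j), $$ where $\xi=(|V_K|-1)\alpha+B$ (a function on $V_H$).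
   Context: For a connected graph $G$ with vertex set $V$, distance function $\operatorname{dist}$, and a function $\rho:V\to\mathbb{R}$, the $\rho$-moment of $G$ at $u$ is $M_G^{\rho}(u)=\sum_{v\in V}\rho(v)\operatorname{dist}(v,u)$ and the $\rho$-moment of $G$ is $M_G^{\rho}=\sum_{u\in V}M_G^{\rho}(u)$. The weight function $\gamma=\alpha+\beta+\cdots+\beta$ on a graph obtained by such identifications assigns to each vertex $v$ of $H$ the value $\alpha(v)$ plus $\beta(y)$ for each copy of $K$ whose vertex $y$ was identified with $v$, and to each non-identified vertex of a copy of $K$ the value of $\beta$ at the corresponding vertex of $K$. $\operatorname{dist}_H$ is the distance in $H$. -}

module Defs where

open import Level using (Level)
open import Data.Nat as ℕ using (ℕ; zero; suc)
open import Data.Fin using (Fin; punchIn)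
open import Data.Fin.Properties using (_≟_)
open import Data.Sum using (_⊎_; inj₁; inj₂)
open import Data.Product using (Σ; Σ-syntax; ∃; _×_; _,_)
open import Relation.Binary.PropositionalEquality using (_≡_)
open import Relation.Nullary using (¬_; Dec; yes; no)
open import Algebra.Bundles using (CommutativeRing)

record Graph (V : Set) : Set₁ where
  field
    Adj   : V → V → Set
    sym   : ∀ {u v} → Adj u v → Adj v u
    irrefl : ∀ {u} → ¬ Adj u u
open Graph public

data Walk {V : Set} (E : V → V → Set) : V → V → ℕ → Set where
  []  : ∀ {u} → Walk E u u 0
  _∷_ : ∀ {u w v n} → E u w → Walk E w v n → Walk E u v (suc n)

Connected : ∀ {V} → Graph V → Set
Connected G = ∀ u v → ∃ λ n → Walk (Adj G) u v n

IsDist : ∀ {V} → (V → V → Set) → (V → V → ℕ) → Set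
IsDist E d = ∀ u v → Walk E u v (d u v) × (∀ n → Walk E u v n → d u v ℕ.≤ n)

-- The glued graph: H on Fin h, K on Fin (suc k) with distinguished y;
-- r copies of K, copy i glued along y to the vertex att i of H.
-- Vertices: inj₁ a (vertices of H, incl. identified ones) or
-- inj₂ (i , j) = copy in K^(i) of the vertex punchIn y j ≠ y.

GV : ℕ → ℕ → ℕ → Set
GV h r k = Fin h ⊎ (Fin r × Fin k)

embK : ∀ {h r k} → Fin (suc k) → (Fin r → Fin h) → Fin r → Fin (suc k) → GV h r k
embK y att i v with v ≟ y
... | yes _ = inj₁ (att i)
... | no v≢y = inj₂ (i , Data.Fin.punchOut v≢y)

GlueAdj : ∀ {h r k} → Graph (Fin h) → Graph (Fin (suc k)) → Fin (suc k) →
          (Fin r → Fin h) → GV h r k → GV h r k → Set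
GlueAdj H K y att a b =
  (Σ[ u ∈ _ ] Σ[ v ∈ _ ] Adj H u v × inj₁ u ≡ a × inj₁ v ≡ b)
  ⊎ (Σ[ i ∈ _ ] Σ[ u ∈ _ ] Σ[ v ∈ _ ]
       Adj K u v × embK y att i u ≡ a × embK y att i v ≡ b)

module WithRing {c ℓ : Level} (R : CommutativeRing c ℓ) where
  open CommutativeRing R
  open import Algebra.Definitions.RawMonoid +-rawMonoid public
    using (sum) renaming (_×_ to _·ℕ_)

  momentAt : ∀ {n} → (Fin n → Fin n → ℕ) → (Fin n → Carrier) → Fin n → Carrier
  momentAt d ρ u = sum (λ v → d v u ·ℕ ρ v)

  moment : ∀ {n} → (Fin n → Fin n → ℕ) → (Fin n → Carrier) → Carrier
  moment d ρ = sum (λ u → momentAt d ρ u)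

  sumGV : ∀ {h r k} → (GV h r k → Carrier) → Carrier
  sumGV f = sum (λ a → f (inj₁ a)) + sum (λ i → sum (λ j → f (inj₂ (i , j))))

  momentGV : ∀ {h r k} → (GV h r k → GV h r k → ℕ) → (GV h r k → Carrier) → Carrier
  momentGV d ρ = sumGV (λ u → sumGV (λ v → d v u ·ℕ ρ v))

  gamma : ∀ {h r k} → Fin (suc k) → (Fin r → Fin h) →
          (Fin h → Carrier) → (Fin (suc k) → Carrier) → GV h r k → Carrier
  gamma y att α β (inj₁ a) = α a + sum (λ i → indic (att i ≟ a))
    where
    indic : ∀ {b c : Fin _} → Dec (b ≡ c) → Carrier
    indic (yes _) = β y
    indic (no _)  = 0#
  gamma y att α β (inj₂ (i , j)) = β (punchIn y j)

-- In a glued graph every distance splits as d v u = dH (foot v) (foot u) + localDist v u, where foot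
-- sends a vertex of a pendant copy of K to the vertex of H it hangs from, and localDist only involves
-- distances inside the copies of K, which do not depend on where the copies are attached.
-- The dH part of the moment is a moment on H for the weight pushed forward along foot; it equals
-- M_H^α + Σ_i M_H^ξ(x_i) + B(|V_K| - 1) Σ_{i,j} dist_H(x_i, x_j). The local part is the same for
-- G₁ and G₂, because the local distance from a vertex of H does not depend on that vertex, and γ puts
-- the same total weight on H in both graphs. Subtracting, with dist_H(x, x) = 0 for G₂, gives the formula.
module Submission where

open import Defs hiding (sym)
open import Data.Nat as ℕ using (ℕ; suc)
import Data.Nat.Properties as ℕ
open import Data.Fin as Fin using (Fin; punchIn)
open import Data.Fin.Properties using (_≟_; punchInᵢ≢i)
open import Data.Product using (_,_)
open import Data.Sum using (inj₁; inj₂)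
open import Function using (_∘_; const)
open import Relation.Nullary using (yes; no; contradiction)
open import Relation.Binary.PropositionalEquality as ≡ using (_≡_)
open import Algebra.Bundles using (CommutativeRing)

module Distances where

  open import Data.Nat using (_+_; _≤_; z≤n; s≤s)
  open import Data.Nat.Properties
    using (≤-antisym; ≤-trans; m≤n⇒m≤1+n; +-mono-≤; +-suc; +-identityʳ; +-comm; n≤0⇒n≡0; +-commutativeSemigroup)
  open import Algebra.Properties.CommutativeSemigroup +-commutativeSemigroup using (x∙yz≈y∙xz)
  open import Data.Product using (∃; ∃₂; _×_; proj₁; proj₂)
  open import Data.Sum using (_⊎_)
  open import Data.Empty using (⊥)
  open import Relation.Nullary using (¬_)
  open import Relation.Binary.PropositionalEquality using (_≢_; refl; cong; cong₂; subst; subst₂)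

  module _ {V : Set} {E : V → V → Set} where

    _++ʷ_ : ∀ {u v w m n} → Walk E u v m → Walk E v w n → Walk E u w (m + n)
    []      ++ʷ q = q
    (e ∷ p) ++ʷ q = e ∷ (p ++ʷ q)

    reverseʷ : (∀ {a b} → E a b → E b a) → ∀ {u v n} → Walk E u v n → Walk E v u n
    reverseʷ E-sym p = subst (Walk E _ _) (+-identityʳ _) (reverse-onto p [])
      where
      reverse-onto : ∀ {u v w m n} → Walk E u v m → Walk E u w n → Walk E v w (m + n)
      reverse-onto []                       acc = acc
      reverse-onto {m = suc m} {n} (e ∷ p) acc =
        subst (Walk E _ _) (+-suc m n) (reverse-onto p (E-sym e ∷ acc))

  module _ {V W : Set} {E : V → V → Set} {F : W → W → Set} (f : V → W)
           (f-edge : ∀ {a b} → E a b → F (f a) (f b) ⊎ f a ≡ f b) where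

    contractʷ : ∀ {u v n} → Walk E u v n → ∃ λ m → m ≤ n × Walk F (f u) (f v) m
    contractʷ [] = 0 , z≤n , []
    contractʷ {v = v} (e ∷ p) with contractʷ p | f-edge e
    ... | m , m≤n , q | inj₁ e′ = suc m , s≤s m≤n , e′ ∷ q
    ... | m , m≤n , q | inj₂ fa≡fb = m , m≤n⇒m≤1+n m≤n , subst (λ a → Walk F a (f v) m) (≡.sym fa≡fb) q

  module _ {V : Set} {E : V → V → Set} {d : V → V → ℕ} (d-isDist : IsDist E d) where

    shortest : ∀ u v → Walk E u v (d u v)
    shortest u v = proj₁ (d-isDist u v)

    dist-minimal : ∀ {u v n} → Walk E u v n → d u v ≤ n
    dist-minimal {u} {v} {n} = proj₂ (d-isDist u v) n

    dist-refl : ∀ u → d u u ≡ 0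
    dist-refl u = n≤0⇒n≡0 (dist-minimal {u} [])

    dist-triangle : ∀ u v w → d u w ≤ d u v + d v w
    dist-triangle u v w = dist-minimal (shortest u v ++ʷ shortest v w)

    dist-sym : (∀ {a b} → E a b → E b a) → ∀ u v → d u v ≡ d v u
    dist-sym E-sym u v = ≤-antisym (dist-minimal (reverseʷ E-sym (shortest v u)))
                                   (dist-minimal (reverseʷ E-sym (shortest u v)))

  dist-contract : ∀ {V W : Set} {E : V → V → Set} {F : W → W → Set} {d d′} →
                  IsDist E d → IsDist F d′ → (f : V → W) →
                  (∀ {a b} → E a b → F (f a) (f b) ⊎ f a ≡ f b) →
                  ∀ u v → d′ (f u) (f v) ≤ d u v
  dist-contract d-isDist d′-isDist f f-edge u v with contractʷ f f-edge (shortest d-isDist u v)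
  ... | m , m≤ , q = ≤-trans (dist-minimal d′-isDist q) m≤

  module _ {h r k : ℕ} where

    foot : (Fin r → Fin h) → GV h r k → Fin h
    foot att (inj₁ a)       = a
    foot att (inj₂ (i , _)) = att i

    hangDist : (Fin r → Fin h) → (GV h r k → GV h r k → ℕ) → Fin r → Fin k → ℕ
    hangDist att d i j = d (inj₂ (i , j)) (inj₁ (att i))

    copyDist : (GV h r k → GV h r k → ℕ) → Fin r → Fin k → Fin k → ℕ
    copyDist d i j′ j = d (inj₂ (i , j′)) (inj₂ (i , j))

    height : (Fin r → Fin k → ℕ) → GV h r k → ℕ
    height e (inj₁ _)       = 0
    height e (inj₂ (i , j)) = e i j

    localDist : (Fin r → Fin k → ℕ) → (Fin r → Fin k → Fin k → ℕ) → GV h r k → GV h r k → ℕ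
    localDist e f (inj₁ _)         u              = height e u
    localDist e f (inj₂ (i , j))   (inj₁ _)       = e i j
    localDist e f (inj₂ (i′ , j′)) (inj₂ (i , j)) with i′ ≟ i
    ... | yes _ = f i j′ j
    ... | no  _ = e i′ j′ + e i j

    localDist-cong : ∀ {e e′ f f′} → (∀ i j → e i j ≡ e′ i j) → (∀ i j′ j → f i j′ j ≡ f′ i j′ j) →
                     ∀ v u → localDist e f v u ≡ localDist e′ f′ v u
    localDist-cong e≗e′ f≗f′ (inj₁ _)         (inj₁ _)       = refl
    localDist-cong e≗e′ f≗f′ (inj₁ _)         (inj₂ (i , j)) = e≗e′ i j
    localDist-cong e≗e′ f≗f′ (inj₂ (i , j))   (inj₁ _)       = e≗e′ i j
    localDist-cong e≗e′ f≗f′ (inj₂ (i′ , j′)) (inj₂ (i , j)) with i′ ≟ i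
    ... | yes _ = f≗f′ i j′ j
    ... | no  _ = cong₂ _+_ (e≗e′ i′ j′) (e≗e′ i j)

  module Glued {h r k : ℕ} (H : Graph (Fin h)) (K : Graph (Fin (suc k))) (y : Fin (suc k))
               (att : Fin r → Fin h) where

    private
      E = GlueAdj H K y att
      emb = embK {h} {r} {k} y att

    glue-sym : ∀ {a b} → E a b → E b a
    glue-sym (inj₁ (u , v , uv , refl , refl))     = inj₁ (v , u , Graph.sym H uv , refl , refl)
    glue-sym (inj₂ (i , u , v , uv , refl , refl)) = inj₂ (i , v , u , Graph.sym K uv , refl , refl)

    foot-embK : ∀ i u → foot att (emb i u) ≡ att i
    foot-embK i u with u ≟ y
    ... | yes _ = refl
    ... | no  _ = refl

    foot-edge : ∀ {a b} → E a b → Adj H (foot att a) (foot att b) ⊎ foot att a ≡ foot att b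
    foot-edge (inj₁ (u , v , uv , refl , refl))    = inj₁ uv
    foot-edge (inj₂ (i , u , v , _ , refl , refl)) = inj₂ (≡.trans (foot-embK i u) (≡.sym (foot-embK i v)))

    inj₁-edge : ∀ {a b} → Adj H a b → E (inj₁ a) (inj₁ b)
    inj₁-edge {a} {b} ab = inj₁ (a , b , ab , refl , refl)

    InCopy : Fin r → GV h r k → Set
    InCopy i (inj₁ _)        = ⊥
    InCopy i (inj₂ (i′ , _)) = i′ ≡ i

    embK-InCopy : ∀ {i i′} u → InCopy i (emb i′ u) → i′ ≡ i
    embK-InCopy u p with u ≟ y
    ... | no _ = p

    embK-cases : ∀ i u → InCopy i (emb i u) ⊎ emb i u ≡ inj₁ (att i)
    embK-cases i u with u ≟ y
    ... | yes _ = inj₂ refl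
    ... | no  _ = inj₁ refl

    leave-step : ∀ {i w w′} → E w w′ → InCopy i w → InCopy i w′ ⊎ w′ ≡ inj₁ (att i)
    leave-step (inj₁ (_ , _ , _ , refl , _)) ()
    leave-step {i} (inj₂ (i′ , u , v , _ , refl , refl)) w∈i with embK-InCopy u w∈i
    ... | refl = embK-cases i v

    exit-walk : ∀ {i w v n} → Walk E w v n → InCopy i w → ¬ InCopy i v →
                ∃₂ λ n₁ n₂ → n₁ + n₂ ≡ n × Walk E w (inj₁ (att i)) n₁ × Walk E (inj₁ (att i)) v n₂
    exit-walk [] w∈i v∉i = contradiction w∈i v∉i
    exit-walk {i} (e ∷ p) w∈i v∉i with leave-step {i} e w∈i
    ... | inj₁ w′∈i with exit-walk p w′∈i v∉i
    ...   | n₁ , n₂ , refl , p₁ , p₂ = suc n₁ , n₂ , refl , e ∷ p₁ , p₂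
    exit-walk (e ∷ p) w∈i v∉i | inj₂ refl = 1 , _ , refl , e ∷ [] , p

    module _ {dH : Fin h → Fin h → ℕ} (dH-isDist : IsDist (Adj H) dH)
             {d : GV h r k → GV h r k → ℕ} (d-isDist : IsDist E d) where

      dist-inj₁ : ∀ a b → d (inj₁ a) (inj₁ b) ≡ dH a b
      dist-inj₁ a b = ≤-antisym
        (dist-contract dH-isDist d-isDist inj₁ (inj₁ ∘ inj₁-edge) a b)
        (dist-contract d-isDist dH-isDist (foot att) foot-edge (inj₁ a) (inj₁ b))

      dist-exit : ∀ i w v → InCopy i w → ¬ InCopy i v →
                  d w v ≡ d w (inj₁ (att i)) + d (inj₁ (att i)) v
      dist-exit i w v w∈i v∉i with exit-walk (shortest d-isDist w v) w∈i v∉i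
      ... | n₁ , n₂ , n₁+n₂≡ , p₁ , p₂ = ≤-antisym
        (dist-triangle d-isDist w (inj₁ (att i)) v)
        (subst (d w (inj₁ (att i)) + d (inj₁ (att i)) v ≤_) n₁+n₂≡
               (+-mono-≤ (dist-minimal d-isDist p₁) (dist-minimal d-isDist p₂)))

      dist-from-copy : ∀ i j a → d (inj₂ (i , j)) (inj₁ a) ≡ dH (att i) a + hangDist att d i j
      dist-from-copy i j a = ≡.trans (dist-exit i _ _ refl λ ())
        (≡.trans (cong (hangDist att d i j +_) (dist-inj₁ (att i) a))
                 (+-comm (hangDist att d i j) (dH (att i) a)))

      dist-to-copy : ∀ a i j → d (inj₁ a) (inj₂ (i , j)) ≡ dH a (att i) + hangDist att d i j
      dist-to-copy a i j = ≡.trans (dist-sym d-isDist glue-sym (inj₁ a) (inj₂ (i , j)))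
        (≡.trans (dist-from-copy i j a)
                 (cong (_+ hangDist att d i j) (dist-sym dH-isDist (Graph.sym H) (att i) a)))

      dist-decompose : ∀ v u →
                       d v u ≡ dH (foot att v) (foot att u) + localDist (hangDist att d) (copyDist d) v u
      dist-decompose (inj₁ a)         (inj₁ b)       = ≡.trans (dist-inj₁ a b) (≡.sym (+-identityʳ (dH a b)))
      dist-decompose (inj₂ (i , j))   (inj₁ a)       = dist-from-copy i j a
      dist-decompose (inj₁ a)         (inj₂ (i , j)) = dist-to-copy a i j
      dist-decompose (inj₂ (i′ , j′)) (inj₂ (i , j)) with i′ ≟ i
      ... | yes refl = cong (_+ copyDist d i j′ j) (≡.sym (dist-refl dH-isDist (att i)))
      ... | no i′≢i = ≡.trans (dist-exit i′ _ _ refl (i′≢i ∘ ≡.sym))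
        (≡.trans (cong (hangDist att d i′ j′ +_) (dist-to-copy (att i′) i j))
                 (x∙yz≈y∙xz (hangDist att d i′ j′) (dH (att i′) (att i)) (hangDist att d i j)))

  -- Collapsing everything outside copy i onto its attachment vertex maps a glued graph onto
  -- another one with a different attachment map, without lengthening walks inside copy i.
  module Transfer {h r k : ℕ} (H : Graph (Fin h)) (K : Graph (Fin (suc k))) (y : Fin (suc k))
                  {att att′ : Fin r → Fin h}
                  {d : GV h r k → GV h r k → ℕ} (d-isDist : IsDist (GlueAdj H K y att) d)
                  {d′ : GV h r k → GV h r k → ℕ} (d′-isDist : IsDist (GlueAdj H K y att′) d′)
                  (i : Fin r) where

    keepCopy : GV h r k → GV h r k
    keepCopy (inj₁ _) = inj₁ (att′ i)
    keepCopy (inj₂ (i″ , j)) with i″ ≟ i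
    ... | yes _ = inj₂ (i″ , j)
    ... | no  _ = inj₁ (att′ i)

    keepCopy-fixes : ∀ j → keepCopy (inj₂ (i , j)) ≡ inj₂ (i , j)
    keepCopy-fixes j with i ≟ i
    ... | yes _  = refl
    ... | no i≢i = contradiction refl i≢i

    keepCopy-embK : ∀ u → keepCopy (embK y att i u) ≡ embK y att′ i u
    keepCopy-embK u with u ≟ y
    ... | yes _ = refl
    ... | no  _ = keepCopy-fixes _

    keepCopy-embK-other : ∀ {i″} → i″ ≢ i → ∀ u → keepCopy (embK y att i″ u) ≡ inj₁ (att′ i)
    keepCopy-embK-other {i″} i″≢i u with u ≟ y
    ... | yes _ = refl
    ... | no  _ with i″ ≟ i
    ...   | yes i″≡i = contradiction i″≡i i″≢i
    ...   | no  _    = refl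

    keepCopy-edge : ∀ {a b} → GlueAdj H K y att a b →
                    GlueAdj H K y att′ (keepCopy a) (keepCopy b) ⊎ keepCopy a ≡ keepCopy b
    keepCopy-edge (inj₁ (_ , _ , _ , refl , refl)) = inj₂ refl
    keepCopy-edge (inj₂ (i″ , u , v , uv , refl , refl)) with i″ ≟ i
    ... | yes refl = inj₁ (inj₂ (i , u , v , uv , ≡.sym (keepCopy-embK u) , ≡.sym (keepCopy-embK v)))
    ... | no i″≢i  = inj₂ (≡.trans (keepCopy-embK-other i″≢i u) (≡.sym (keepCopy-embK-other i″≢i v)))

    hangDist-≤ : ∀ j → hangDist att′ d′ i j ≤ hangDist att d i j
    hangDist-≤ j = subst (λ w → d′ w (inj₁ (att′ i)) ≤ hangDist att d i j) (keepCopy-fixes j)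
      (dist-contract d-isDist d′-isDist keepCopy keepCopy-edge (inj₂ (i , j)) (inj₁ (att i)))

    copyDist-≤ : ∀ j′ j → copyDist d′ i j′ j ≤ copyDist d i j′ j
    copyDist-≤ j′ j = subst₂ (λ w w′ → d′ w w′ ≤ copyDist d i j′ j) (keepCopy-fixes j′) (keepCopy-fixes j)
      (dist-contract d-isDist d′-isDist keepCopy keepCopy-edge (inj₂ (i , j′)) (inj₂ (i , j)))

  module _ {h r k : ℕ} (H : Graph (Fin h)) (K : Graph (Fin (suc k))) (y : Fin (suc k))
           {att att′ : Fin r → Fin h}
           {d : GV h r k → GV h r k → ℕ} (d-isDist : IsDist (GlueAdj H K y att) d)
           {d′ : GV h r k → GV h r k → ℕ} (d′-isDist : IsDist (GlueAdj H K y att′) d′) where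

    hangDist-invariant : ∀ i j → hangDist att d i j ≡ hangDist att′ d′ i j
    hangDist-invariant i j = ≤-antisym (Transfer.hangDist-≤ H K y d′-isDist d-isDist i j)
                                       (Transfer.hangDist-≤ H K y d-isDist d′-isDist i j)

    copyDist-invariant : ∀ i j′ j → copyDist d i j′ j ≡ copyDist d′ i j′ j
    copyDist-invariant i j′ j = ≤-antisym (Transfer.copyDist-≤ H K y d′-isDist d-isDist i j′ j)
                                          (Transfer.copyDist-≤ H K y d-isDist d′-isDist i j′ j)

open Distances

module Moments {c ℓ} (R : CommutativeRing c ℓ) where

  open CommutativeRing R
  open WithRing R
  open import Algebra.Properties.Semiring.Sum semiring
    using (sum-cong-≋; ∑-distrib-+; ∑-comm; sum-remove; sum-replicate; sum-replicate-zero; *-distribˡ-sum)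
  open import Algebra.Properties.Semiring.Mult semiring using (×-assoc-*; ×-congʳ; ×-congˡ; ×-assocˡ)
  open import Algebra.Properties.CommutativeMonoid.Mult +-commutativeMonoid using (×-distrib-+; ×-homo-+)
  open import Algebra.Properties.CommutativeSemigroup +-commutativeSemigroup using (interchange)
  open import Algebra.Properties.Ring ring using (-1*x≈-x; -‿+-comm)
  open import Algebra.Solver.Ring.NaturalCoefficients.Default commutativeSemiring using (solve; _:+_; _:*_; _:=_)
  open import Relation.Binary.Reasoning.Setoid setoid

  ⟨_⟩ : ℕ → Carrier
  ⟨ n ⟩ = n ·ℕ 1#

  ×≈⟨⟩* : ∀ n x → n ·ℕ x ≈ ⟨ n ⟩ * x
  ×≈⟨⟩* n x = sym (trans (×-assoc-* n 1# x) (×-congʳ n (*-identityˡ x)))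

  ×-zeroʳ : ∀ n → n ·ℕ 0# ≈ 0#
  ×-zeroʳ n = trans (×≈⟨⟩* n 0#) (zeroʳ ⟨ n ⟩)

  ×-comm : ∀ m n x → m ·ℕ (n ·ℕ x) ≈ n ·ℕ (m ·ℕ x)
  ×-comm m n x = trans (×-assocˡ x m n) (trans (×-congˡ (ℕ.*-comm m n)) (sym (×-assocˡ x n m)))

  ×-distrib-sum : ∀ {m} n (f : Fin m → Carrier) → n ·ℕ sum f ≈ sum (λ i → n ·ℕ f i)
  ×-distrib-sum n f = trans (×≈⟨⟩* n (sum f))
    (trans (*-distribˡ-sum ⟨ n ⟩ f) (sum-cong-≋ λ i → sym (×≈⟨⟩* n (f i))))

  ∑-distrib-− : ∀ {m} (f g : Fin m → Carrier) → sum (λ i → f i - g i) ≈ sum f - sum g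
  ∑-distrib-− f g = trans (∑-distrib-+ f (-_ ∘ g)) (+-congˡ neg-sum)
    where
    neg-sum : sum (-_ ∘ g) ≈ - sum g
    neg-sum = begin
      sum (-_ ∘ g)                ≈⟨ sum-cong-≋ (λ i → -1*x≈-x (g i)) ⟨
      sum (λ i → - 1# * g i)      ≈⟨ *-distribˡ-sum (- 1#) g ⟨
      - 1# * sum g                ≈⟨ -1*x≈-x (sum g) ⟩
      - sum g                     ∎

  +-sub-+ : ∀ a b a′ b′ → (a + b) - (a′ + b′) ≈ (a - a′) + (b - b′)
  +-sub-+ a b a′ b′ = trans (+-congˡ (sym (-‿+-comm a′ b′))) (interchange a b (- a′) (- b′))

  pointAt : ∀ {n} → Fin n → Carrier → Fin n → Carrier
  pointAt c x b with c ≟ b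
  ... | yes _ = x
  ... | no  _ = 0#

  sum-pointAt : ∀ {m} (n : Fin m → ℕ) c x → sum (λ b → n b ·ℕ pointAt c x b) ≈ n c ·ℕ x
  sum-pointAt {suc m} n c x = begin
    sum (λ b → n b ·ℕ pointAt c x b)
      ≈⟨ sum-remove {i = c} (λ b → n b ·ℕ pointAt c x b) ⟩
    n c ·ℕ pointAt c x c + sum (λ j → n (punchIn c j) ·ℕ pointAt c x (punchIn c j))
      ≈⟨ +-cong (×-congʳ (n c) here) (trans (sum-cong-≋ elsewhere) (sum-replicate-zero m)) ⟩
    n c ·ℕ x + 0#
      ≈⟨ +-identityʳ _ ⟩
    n c ·ℕ x ∎
    where
    here : pointAt c x c ≈ x
    here with c ≟ c
    ... | yes _  = refl
    ... | no c≢c = contradiction ≡.refl c≢c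
    elsewhere : ∀ j → n (punchIn c j) ·ℕ pointAt c x (punchIn c j) ≈ 0#
    elsewhere j with c ≟ punchIn c j
    ... | yes c≡ = contradiction (≡.sym c≡) (punchInᵢ≢i c j)
    ... | no  _  = ×-zeroʳ (n (punchIn c j))

  private
    +-shift : ∀ a b s p → (a + b) + s ≈ (a + b) + p → a + (b + s) ≈ a + (b + p)
    +-shift a b s p eq = trans (sym (+-assoc a b s)) (trans eq (+-assoc a b p))

  -- The indicator inside gamma is local to its definition, so it is reached by with-abstraction,
  -- one copy at a time, with the copies already handled absorbed into α.
  gamma-inj₁ : ∀ {h r k} (y : Fin (suc k)) (att : Fin r → Fin h) α β b →
               gamma y att α β (inj₁ b) ≈ α b + sum (λ i → pointAt (att i) (β y) b)
  gamma-inj₁ {r = ℕ.zero}  y att α β b = refl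
  gamma-inj₁ {r = suc r} y att α β b with att Fin.zero ≟ b
  ... | yes _ = +-shift _ _ _ _ (gamma-inj₁ y (att ∘ Fin.suc) (const (α b + β y)) β b)
  ... | no  _ = +-shift _ _ _ _ (gamma-inj₁ y (att ∘ Fin.suc) (const (α b + 0#)) β b)

  sumGV-cong : ∀ {h r k} {f g : GV h r k → Carrier} → (∀ v → f v ≈ g v) → sumGV f ≈ sumGV g
  sumGV-cong f≈g = +-cong (sum-cong-≋ (f≈g ∘ inj₁)) (sum-cong-≋ λ i → sum-cong-≋ λ j → f≈g (inj₂ (i , j)))

  sumGV-distrib-+ : ∀ {h r k} (f g : GV h r k → Carrier) → sumGV (λ v → f v + g v) ≈ sumGV f + sumGV g
  sumGV-distrib-+ f g = trans
    (+-cong (∑-distrib-+ (f ∘ inj₁) (g ∘ inj₁))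
            (trans (sum-cong-≋ λ i → ∑-distrib-+ (λ j → f (inj₂ (i , j))) (λ j → g (inj₂ (i , j))))
                   (∑-distrib-+ (λ i → sum λ j → f (inj₂ (i , j))) (λ i → sum λ j → g (inj₂ (i , j))))))
    (interchange (sum (f ∘ inj₁)) (sum (g ∘ inj₁))
                 (sum λ i → sum λ j → f (inj₂ (i , j))) (sum λ i → sum λ j → g (inj₂ (i , j))))

  module _ {h r k : ℕ} (y : Fin (suc k)) (att : Fin r → Fin h) (α : Fin h → Carrier)
           (β : Fin (suc k) → Carrier) where

    private
      γ : GV h r k → Carrier
      γ = gamma y att α β

    sum-gamma-inj₁ : ∀ (n : Fin h → ℕ) →
                     sum (λ b → n b ·ℕ γ (inj₁ b))
                     ≈ sum (λ b → n b ·ℕ α b) + sum (λ i → n (att i) ·ℕ β y)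
    sum-gamma-inj₁ n = begin
      sum (λ b → n b ·ℕ γ (inj₁ b))
        ≈⟨ sum-cong-≋ (λ b → ×-congʳ (n b) (gamma-inj₁ y att α β b)) ⟩
      sum (λ b → n b ·ℕ (α b + sum (λ i → pointAt (att i) (β y) b)))
        ≈⟨ sum-cong-≋ (λ b → trans (×-distrib-+ _ _ (n b))
                                   (+-congˡ (×-distrib-sum (n b) (λ i → pointAt (att i) (β y) b)))) ⟩
      sum (λ b → n b ·ℕ α b + sum (λ i → n b ·ℕ pointAt (att i) (β y) b))
        ≈⟨ ∑-distrib-+ (λ b → n b ·ℕ α b) (λ b → sum (λ i → n b ·ℕ pointAt (att i) (β y) b)) ⟩
      sum (λ b → n b ·ℕ α b) + sum (λ b → sum (λ i → n b ·ℕ pointAt (att i) (β y) b))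
        ≈⟨ +-congˡ (trans (∑-comm (λ b i → n b ·ℕ pointAt (att i) (β y) b))
                          (sum-cong-≋ λ i → sum-pointAt n (att i) (β y))) ⟩
      sum (λ b → n b ·ℕ α b) + sum (λ i → n (att i) ·ℕ β y) ∎

    sumGV-foot-gamma : ∀ (n : Fin h → ℕ) →
                       sumGV (λ v → n (foot att v) ·ℕ γ v)
                       ≈ sum (λ b → n b ·ℕ α b) + sum (λ i → n (att i) ·ℕ sum β)
    sumGV-foot-gamma n = begin
      sum (λ b → n b ·ℕ γ (inj₁ b)) + sum (λ i → sum (λ j → n (att i) ·ℕ β (punchIn y j)))
        ≈⟨ +-cong (sum-gamma-inj₁ n) (sum-cong-≋ λ i → sym (×-distrib-sum (n (att i)) (β ∘ punchIn y))) ⟩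
      (sum (λ b → n b ·ℕ α b) + sum (λ i → n (att i) ·ℕ β y)) + sum (λ i → n (att i) ·ℕ sum (β ∘ punchIn y))
        ≈⟨ +-assoc _ _ _ ⟩
      sum (λ b → n b ·ℕ α b) + (sum (λ i → n (att i) ·ℕ β y) + sum (λ i → n (att i) ·ℕ sum (β ∘ punchIn y)))
        ≈⟨ +-congˡ (∑-distrib-+ (λ i → n (att i) ·ℕ β y) (λ i → n (att i) ·ℕ sum (β ∘ punchIn y))) ⟨
      sum (λ b → n b ·ℕ α b) + sum (λ i → n (att i) ·ℕ β y + n (att i) ·ℕ sum (β ∘ punchIn y))
        ≈⟨ +-congˡ (sum-cong-≋ λ i → trans (sym (×-distrib-+ _ _ (n (att i))))
                                           (×-congʳ (n (att i)) (sym (sum-remove {i = y} β)))) ⟩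
      sum (λ b → n b ·ℕ α b) + sum (λ i → n (att i) ·ℕ sum β) ∎

    sumGV-foot : ∀ (F : Fin h → Carrier) → sumGV {k = k} (F ∘ foot att) ≈ sum F + k ·ℕ sum (F ∘ att)
    sumGV-foot F =
      +-congˡ (trans (sum-cong-≋ λ i → sum-replicate k {F (att i)}) (sym (×-distrib-sum k (F ∘ att))))

  pairwiseDist : ∀ {h r} → (Fin h → Fin h → ℕ) → (Fin r → Fin h) → Carrier
  pairwiseDist dH att = sum (λ i → sum (λ j → dH (att i) (att j) ·ℕ 1#))

  module _ {h r k : ℕ} {dH : Fin h → Fin h → ℕ} (dH-sym : ∀ a b → dH a b ≡ dH b a)
           (y : Fin (suc k)) (att : Fin r → Fin h) (α : Fin h → Carrier) (β : Fin (suc k) → Carrier) where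

    private
      B : Carrier
      B = sum β
      ξ : Fin h → Carrier
      ξ v = k ·ℕ α v + B

    momentAt-ξ : ∀ u → momentAt dH ξ u ≈ k ·ℕ momentAt dH α u + momentAt dH (const B) u
    momentAt-ξ u = trans
      (sum-cong-≋ λ v → trans (×-distrib-+ (k ·ℕ α v) B (dH v u)) (+-congʳ (×-comm (dH v u) k (α v))))
      (trans (∑-distrib-+ (λ v → k ·ℕ (dH v u ·ℕ α v)) (λ v → dH v u ·ℕ B))
             (+-congʳ (sym (×-distrib-sum k (λ v → dH v u ·ℕ α v)))))

    footMoment : sumGV {k = k} (λ u → sumGV (λ v → dH (foot att v) (foot att u) ·ℕ gamma y att α β v))
                 ≈ moment dH α + sum (λ i → momentAt dH ξ (att i)) + (B * ⟨ k ⟩) * pairwiseDist dH att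
    footMoment = begin
      sumGV {k = k} (λ u → sumGV (λ v → dH (foot att v) (foot att u) ·ℕ gamma y att α β v))
        ≈⟨ sumGV-cong {k = k} (λ u → sumGV-foot-gamma y att α β (λ b → dH b (foot att u))) ⟩
      sumGV {k = k} (Φ ∘ foot att)
        ≈⟨ sumGV-foot y att α β Φ ⟩
      sum Φ + k ·ℕ sum (Φ ∘ att)
        ≈⟨ +-cong sum-Φ (trans (×≈⟨⟩* k (sum (Φ ∘ att))) (*-congˡ sum-Φ-att)) ⟩
      (moment dH α + Mᴮ) + ⟨ k ⟩ * (Mᵅ + B * pairwiseDist dH att)
        ≈⟨ solve 6 (λ A P Q b U κ → (A :+ P) :+ κ :* (Q :+ b :* U) := A :+ (κ :* Q :+ P) :+ (b :* κ) :* U)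
                 refl (moment dH α) Mᴮ Mᵅ B (pairwiseDist dH att) ⟨ k ⟩ ⟩
      moment dH α + (⟨ k ⟩ * Mᵅ + Mᴮ) + (B * ⟨ k ⟩) * pairwiseDist dH att
        ≈⟨ +-congʳ (+-congˡ sum-momentAt-ξ) ⟨
      moment dH α + sum (λ i → momentAt dH ξ (att i)) + (B * ⟨ k ⟩) * pairwiseDist dH att ∎
      where
      Φ : Fin h → Carrier
      Φ a = momentAt dH α a + sum (λ i → dH (att i) a ·ℕ B)
      Mᵅ Mᴮ : Carrier
      Mᵅ = sum (λ i → momentAt dH α (att i))
      Mᴮ = sum (λ i → momentAt dH (const B) (att i))

      sum-Φ : sum Φ ≈ moment dH α + Mᴮ
      sum-Φ = trans (∑-distrib-+ (momentAt dH α) (λ a → sum (λ i → dH (att i) a ·ℕ B)))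
        (+-congˡ (trans (∑-comm (λ a i → dH (att i) a ·ℕ B))
                        (sum-cong-≋ λ i → sum-cong-≋ λ a → ×-congˡ (dH-sym (att i) a))))

      sum-Φ-att : sum (Φ ∘ att) ≈ Mᵅ + B * pairwiseDist dH att
      sum-Φ-att = trans
        (∑-distrib-+ (λ i → momentAt dH α (att i)) (λ i → sum (λ i′ → dH (att i′) (att i) ·ℕ B)))
        (+-congˡ (sym (trans (*-distribˡ-sum B (λ i → sum (λ j → dH (att i) (att j) ·ℕ 1#)))
          (sum-cong-≋ λ i → trans (*-distribˡ-sum B (λ j → dH (att i) (att j) ·ℕ 1#))
            (sum-cong-≋ λ j → trans (*-comm B _)
              (trans (sym (×≈⟨⟩* (dH (att i) (att j)) B)) (×-congˡ (dH-sym (att i) (att j)))))))))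

      sum-momentAt-ξ : sum (λ i → momentAt dH ξ (att i)) ≈ ⟨ k ⟩ * Mᵅ + Mᴮ
      sum-momentAt-ξ = trans (sum-cong-≋ (momentAt-ξ ∘ att))
        (trans (∑-distrib-+ (λ i → k ·ℕ momentAt dH α (att i)) (λ i → momentAt dH (const B) (att i)))
               (+-congʳ (trans (sym (×-distrib-sum k (λ i → momentAt dH α (att i)))) (×≈⟨⟩* k Mᵅ))))

  localMoment : ∀ {h r k} → (Fin r → Fin k → ℕ) → (Fin r → Fin k → Fin k → ℕ) →
                Fin (suc k) → (Fin r → Fin h) → (Fin h → Carrier) → (Fin (suc k) → Carrier) → Carrier
  localMoment e f y att α β = sumGV (λ u → sumGV (λ v → localDist e f v u ·ℕ gamma y att α β v))

  localMoment-cong : ∀ {h r k} {e e′ f f′} y (att : Fin r → Fin h) α (β : Fin (suc k) → Carrier) →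
                     (∀ i j → e i j ≡ e′ i j) → (∀ i j′ j → f i j′ j ≡ f′ i j′ j) →
                     localMoment e f y att α β ≈ localMoment e′ f′ y att α β
  localMoment-cong y att α β e≗e′ f≗f′ =
    sumGV-cong λ u → sumGV-cong λ v → ×-congˡ {gamma y att α β v} (localDist-cong e≗e′ f≗f′ v u)

  localMoment-attachment-invariant : ∀ {h r k} e f y (att att′ : Fin r → Fin h) α
                                       (β : Fin (suc k) → Carrier) →
                                     localMoment e f y att α β ≈ localMoment e f y att′ α β
  localMoment-attachment-invariant e f y att att′ α β = sumGV-cong same-from
    where
    same-from : ∀ u → sumGV (λ v → localDist e f v u ·ℕ gamma y att α β v)
                      ≈ sumGV (λ v → localDist e f v u ·ℕ gamma y att′ α β v)
    same-from u = +-congʳ (trans (sum-gamma-inj₁ y att α β (const (height e u)))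
                                 (sym (sum-gamma-inj₁ y att′ α β (const (height e u)))))

  moment-glued : ∀ {h r k} (H : Graph (Fin h)) (K : Graph (Fin (suc k)))
                 {y : Fin (suc k)} {att : Fin r → Fin h}
                 {dH} → IsDist (Adj H) dH → ∀ {d} → IsDist (GlueAdj H K y att) d → ∀ α β →
                 momentGV d (gamma y att α β)
                 ≈ moment dH α + sum (λ i → momentAt dH (λ v → k ·ℕ α v + sum β) (att i))
                   + (sum β * ⟨ k ⟩) * pairwiseDist dH att
                   + localMoment (hangDist att d) (copyDist d) y att α β
  moment-glued {h} {r} {k} H K {y} {att} {dH} dH-isDist {d} d-isDist α β = begin
    sumGV (λ u → sumGV (λ v → d v u ·ℕ γ v))
      ≈⟨ sumGV-cong (λ u → sumGV-cong (split u)) ⟩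
    sumGV (λ u → sumGV (λ v → footTerm u v + localTerm u v))
      ≈⟨ sumGV-cong (λ u → sumGV-distrib-+ (footTerm u) (localTerm u)) ⟩
    sumGV (λ u → sumGV (footTerm u) + sumGV (localTerm u))
      ≈⟨ sumGV-distrib-+ (sumGV ∘ footTerm) (sumGV ∘ localTerm) ⟩
    sumGV (sumGV ∘ footTerm) + localMoment e f y att α β
      ≈⟨ +-congʳ (footMoment (dist-sym dH-isDist (Graph.sym H)) y att α β) ⟩
    _ ∎
    where
    γ : GV h r k → Carrier
    γ = gamma y att α β
    e : Fin r → Fin k → ℕ
    e = hangDist att d
    f : Fin r → Fin k → Fin k → ℕ
    f = copyDist d
    footTerm localTerm : GV h r k → GV h r k → Carrier
    footTerm u v = dH (foot att v) (foot att u) ·ℕ γ v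
    localTerm u v = localDist e f v u ·ℕ γ v
    split : ∀ u v → d v u ·ℕ γ v ≈ footTerm u v + localTerm u v
    split u v = trans (×-congˡ (Glued.dist-decompose H K y att dH-isDist d-isDist v u))
                      (×-homo-+ (γ v) (dH (foot att v) (foot att u)) (localDist e f v u))

  pairwiseDist-const : ∀ {h r} {dH : Fin h → Fin h → ℕ} {x} →
                       dH x x ≡ 0 → pairwiseDist dH (const {B = Fin r} x) ≈ 0#
  pairwiseDist-const {r = r} {dH} {x} dxx≡0 = trans (sum-cong-≋ row-zero) (sum-replicate-zero r)
    where
    row-zero : ∀ (i : Fin r) → sum {r} (λ _ → dH x x ·ℕ 1#) ≈ 0#
    row-zero i = trans (sum-cong-≋ {r} λ j → ×-congˡ {1#} dxx≡0) (sum-replicate-zero r)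

  sub-common : ∀ a b b′ c c′ l l′ → c ≈ 0# → l ≈ l′ →
               (a + b + c + l) - (a + b′ + c′ + l′) ≈ (b - b′) - c′
  sub-common a b b′ c c′ l l′ c≈0 l≈l′ = begin
    (a + b + c + l) - (a + b′ + c′ + l′)
      ≈⟨ +-sub-+ (a + b + c) l (a + b′ + c′) l′ ⟩
    ((a + b + c) - (a + b′ + c′)) + (l - l′)
      ≈⟨ +-congʳ (+-sub-+ (a + b) c (a + b′) c′) ⟩
    (((a + b) - (a + b′)) + (c - c′)) + (l - l′)
      ≈⟨ +-congʳ (+-congʳ (+-sub-+ a b a b′)) ⟩
    (((a - a) + (b - b′)) + (c - c′)) + (l - l′)
      ≈⟨ +-cong (+-cong (+-congʳ (-‿inverseʳ a)) (+-congʳ c≈0)) (trans (+-congʳ l≈l′) (-‿inverseʳ l′)) ⟩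
    ((0# + (b - b′)) + (0# - c′)) + 0#
      ≈⟨ trans (+-identityʳ _) (+-cong (+-identityˡ _) (+-identityˡ _)) ⟩
    (b - b′) - c′ ∎

corollary3p2 :
    ∀ {c ℓ ℓ'} (R : CommutativeRing c ℓ)
      (_≤_ : CommutativeRing.Carrier R → CommutativeRing.Carrier R → Set ℓ')
      {h k r : ℕ}
      (H : Graph (Fin h)) (K : Graph (Fin (suc k))) →
      Connected H → Connected K →
      (α : Fin h → CommutativeRing.Carrier R)
      (β : Fin (suc k) → CommutativeRing.Carrier R) →
      (∀ v → CommutativeRing.0# R ≤ α v) →
      (∀ v → CommutativeRing.0# R ≤ β v) →
      (xs : Fin r → Fin h) (x : Fin h) (y : Fin (suc k)) →
      (dH : Fin h → Fin h → ℕ) → IsDist (Adj H) dH →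
      (dG₁ : GV h r k → GV h r k → ℕ) → IsDist (GlueAdj H K y xs) dG₁ →
      (dG₂ : GV h r k → GV h r k → ℕ) → IsDist (GlueAdj H K y (const x)) dG₂ →
      let open CommutativeRing R
          open WithRing R
          B = sum β
          ξ = λ v → (k ·ℕ α v) + B
      in momentGV dG₂ (gamma y (const x) α β) - momentGV dG₁ (gamma y xs α β)
         ≈ sum (λ i → momentAt dH ξ x - momentAt dH ξ (xs i))
           - (B * (k ·ℕ 1#)) * sum (λ i → sum (λ j → dH (xs i) (xs j) ·ℕ 1#))
-- Connectedness is already implied by the existence of the distance functions, and the
-- identity holds for arbitrary weights.
corollary3p2 R _ {h} {k} {r} H K _ _ α β _ _ xs x y dH dH-isDist dG₁ G₁-isDist dG₂ G₂-isDist = begin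
  momentGV dG₂ (gamma y (const x) α β) - momentGV dG₁ (gamma y xs α β)
    ≈⟨ +-cong (moment-glued H K dH-isDist G₂-isDist α β)
              (-‿cong (moment-glued H K dH-isDist G₁-isDist α β)) ⟩
  (moment dH α + sum {r} (const (Mξ x)) + c * pairwiseDist dH (const {B = Fin r} x) + L₂)
    - (moment dH α + sum (Mξ ∘ xs) + c * pairwiseDist dH xs + L₁)
    ≈⟨ sub-common _ _ _ _ _ _ _ no-pairs L₂≈L₁ ⟩
  (sum {r} (const (Mξ x)) - sum (Mξ ∘ xs)) - c * pairwiseDist dH xs
    ≈⟨ +-congʳ (∑-distrib-− {r} (const (Mξ x)) (Mξ ∘ xs)) ⟨
  sum (λ i → Mξ x - Mξ (xs i)) - c * pairwiseDist dH xs ∎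
  where
  open CommutativeRing R
  open WithRing R
  open Moments R
  open import Relation.Binary.Reasoning.Setoid setoid
  Mξ : Fin h → Carrier
  Mξ = momentAt dH (λ v → (k ·ℕ α v) + sum β)
  c : Carrier
  c = sum β * ⟨ k ⟩
  L₁ L₂ : Carrier
  L₁ = localMoment (hangDist xs dG₁) (copyDist dG₁) y xs α β
  L₂ = localMoment (hangDist (const x) dG₂) (copyDist dG₂) y (const x) α β
  no-pairs : c * pairwiseDist dH (const {B = Fin r} x) ≈ 0#
  no-pairs = trans (*-congˡ (pairwiseDist-const {r = r} {dH} {x} (dist-refl dH-isDist x))) (zeroʳ c)
  L₂≈L₁ : L₂ ≈ L₁
  L₂≈L₁ = trans (localMoment-cong y (const x) α β (hangDist-invariant H K y G₂-isDist G₁-isDist)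
                                                 (copyDist-invariant H K y G₂-isDist G₁-isDist))
                (localMoment-attachment-invariant (hangDist xs dG₁) (copyDist dG₁) y (const x) xs α β)
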